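{- The principal ideal of instance degrees below the degree of $\top_{\mathbf 1}$ (i.e. the set of instance degrees of predicates $\phi$ with $\phi\sqsubseteq\top_{\mathbf 1}$) is order-equivalent to the poset $\Omega$ of truth values ordered by implication.
   Context: Work in intuitionistic higher-order logic (e.g. the internal language of an elementary topos), without excluded middle and without countable choice. $\Omega$ is the set of truth values. A predicate $\phi$ on a set $A$ is a subset of $A$. A predicate $\phi$ on $A$ is instance reducible to a predicate $\psi$ on $B$, written $\phi\sqsubseteq\psi$, when $\forall x\in A\,\exists y\in B\,(\psi(y)\Rightarrow\phi(x))$; the instance degrees are the classes of predicates under mutual reducibility, ordered by $\sqsubseteq$. $\mathbf 1=\{\star\}$ is a singleton and $\top_{\mathbf 1}$ is the always true predicate on $\mathbf 1$. -}

module Defs where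

open import Level using (Level; suc; _⊔_)
open import Data.Unit using (⊤; tt)
open import Data.Product using (Σ; _×_; _,_; proj₁; proj₂)
open import Function.Bundles using (_⇔_)

-- Truth values, propositions-as-types: a truth value is a type,
-- truth values being identified up to logical equivalence.
Ω : Set₁
Ω = Set

_⇒Ω_ : Ω → Ω → Set
P ⇒Ω Q = P → Q

record Predicate : Set₁ where
  constructor pred
  field
    Dom : Set
    holds : Dom → Ω
open Predicate public

_⊑_ : Predicate → Predicate → Set
φ ⊑ ψ = (x : Dom φ) → Σ (Dom ψ) (λ y → holds ψ y → holds φ x)

⊤₁ : Predicate
⊤₁ = pred ⊤ (λ _ → ⊤)

-- The principal ideal below ⊤₁ (as a preorder; its elements up to
-- mutual reducibility are the instance degrees ≤ deg ⊤₁).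
BelowTop : Set₁
BelowTop = Σ Predicate (λ φ → φ ⊑ ⊤₁)

_⊑ᵢ_ : BelowTop → BelowTop → Set
x ⊑ᵢ y = proj₁ x ⊑ proj₁ y

-- Order equivalence between two preorders (i.e. an isomorphism between
-- their posetal reflections): maps f, g which preserve and reflect the
-- order and are mutually inverse up to the induced equivalence.
record OrderEquivalence {a b ℓ₁ ℓ₂ : Level}
    (X : Set a) (_≤X_ : X → X → Set ℓ₁)
    (Y : Set b) (_≤Y_ : Y → Y → Set ℓ₂) : Set (a ⊔ b ⊔ ℓ₁ ⊔ ℓ₂) where
  field
    to   : X → Y
    from : Y → X
    to-order   : ∀ x x′ → (x ≤X x′) ⇔ (to x ≤Y to x′)
    from-order : ∀ y y′ → (y ≤Y y′) ⇔ (from y ≤X from y′)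
    from-to : ∀ x → (from (to x) ≤X x) × (x ≤X from (to x))
    to-from : ∀ y → (to (from y) ≤Y y) × (y ≤Y to (from y))

{-# OPTIONS --safe #-}
module Submission where

-- A predicate φ with φ ⊑ ⊤₁ holds at every instance, and between predicates
-- that hold everywhere reducibility is just the existence of a map between
-- their domains. So such a φ is determined, up to degree, by the truth value
-- "Dom φ is inhabited", and a truth value P comes back as the always-true
-- predicate on P.

open import Defs
open import Data.Unit using (⊤; tt)
open import Data.Product using (_,_; proj₁; proj₂)
open import Function.Base using (id)
open import Function.Bundles using (_⇔_; mk⇔)
open import Function.Properties.Equivalence using () renaming (sym to ⇔-sym)

HoldsEverywhere : Predicate → Set
HoldsEverywhere φ = ∀ x → holds φ x

⊑⊤₁⇒holdsEverywhere : ∀ {φ} → φ ⊑ ⊤₁ → HoldsEverywhere φ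
⊑⊤₁⇒holdsEverywhere φ⊑⊤₁ x = proj₂ (φ⊑⊤₁ x) tt

⊑⇒Dom-map : ∀ {φ ψ} → φ ⊑ ψ → Dom φ → Dom ψ
⊑⇒Dom-map φ⊑ψ x = proj₁ (φ⊑ψ x)

Dom-map⇒⊑ : ∀ {φ ψ} → HoldsEverywhere φ → (Dom φ → Dom ψ) → φ ⊑ ψ
Dom-map⇒⊑ φ-holds f x = f x , λ _ → φ-holds x

⊑⇔Dom-map : ∀ {φ ψ} → HoldsEverywhere φ → (φ ⊑ ψ) ⇔ (Dom φ → Dom ψ)
⊑⇔Dom-map φ-holds = mk⇔ ⊑⇒Dom-map (Dom-map⇒⊑ φ-holds)

⊤-on : Ω → Predicate
⊤-on P = pred P (λ _ → ⊤)

⊤-on-holdsEverywhere : ∀ P → HoldsEverywhere (⊤-on P)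
⊤-on-holdsEverywhere P _ = tt

⊤-on-⊑⊤₁ : ∀ P → ⊤-on P ⊑ ⊤₁
⊤-on-⊑⊤₁ P = Dom-map⇒⊑ (⊤-on-holdsEverywhere P) _

proposition2p10 : OrderEquivalence BelowTop _⊑ᵢ_ Ω _⇒Ω_
proposition2p10 = record
  { to         = λ (φ , _) → Dom φ
  ; from       = λ P → ⊤-on P , ⊤-on-⊑⊤₁ P
  ; to-order   = λ (_ , φ⊑⊤₁) _ → ⊑⇔Dom-map (⊑⊤₁⇒holdsEverywhere φ⊑⊤₁)
  ; from-order = λ P _ → ⇔-sym (⊑⇔Dom-map (⊤-on-holdsEverywhere P))
  ; from-to    = λ (φ , φ⊑⊤₁) → Dom-map⇒⊑ (⊤-on-holdsEverywhere (Dom φ)) id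
                              , Dom-map⇒⊑ (⊑⊤₁⇒holdsEverywhere φ⊑⊤₁) id
  ; to-from    = λ _ → id , id
  }
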